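{- Let $(A,\to,1)$ be an algebra of type $(2,0)$. Then: (a) (Re), (L), (Ex) and (**) imply (p-2); (b) (Ex), (B), (*) and (pi) imply (p-1); (c) (p-1), (p-2) and (An) imply (pimpl); (d) (Re), (Ex), (B), (**), (*), (L), (An) and (pi) together imply (pimpl).
   Context: Properties, for all $x,y,z\in A$: (Re) $x\to x=1$; (L) $x\to 1=1$; (Ex) $x\to(y\to z)=y\to(x\to z)$; (B) $(y\to z)\to[(x\to y)\to(x\to z)]=1$; (*) $y\to z=1\Rightarrow (x\to y)\to(x\to z)=1$; (**) $y\to z=1\Rightarrow (z\to x)\to(y\to x)=1$; (An) $x\to y=1=y\to x\Rightarrow x=y$; (pi) $y\to(y\to x)=y\to x$; (pimpl) $x\to(y\to z)=(x\to y)\to(x\to z)$; (p-1) $[x\to(y\to z)]\to[(x\to y)\to(x\to z)]=1$; (p-2) $[(x\to y)\to(x\to z)]\to[x\to(y\to z)]=1$. -}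

module Defs where

open import Level using (Level; suc; _⊔_)
open import Data.Product using (_×_)
open import Relation.Binary.PropositionalEquality using (_≡_)

record Alg20 (a : Level) : Set (suc a) where
  infixr 25 _⇒_
  field
    Carrier : Set a
    _⇒_     : Carrier → Carrier → Carrier
    one     : Carrier

module _ {a : Level} (𝔸 : Alg20 a) where
  open Alg20 𝔸

  Re : Set a
  Re = ∀ x → x ⇒ x ≡ one

  L : Set a
  L = ∀ x → x ⇒ one ≡ one

  Ex : Set a
  Ex = ∀ x y z → x ⇒ (y ⇒ z) ≡ y ⇒ (x ⇒ z)

  B : Set a
  B = ∀ x y z → (y ⇒ z) ⇒ ((x ⇒ y) ⇒ (x ⇒ z)) ≡ one

  Star : Set a
  Star = ∀ x y z → y ⇒ z ≡ one → (x ⇒ y) ⇒ (x ⇒ z) ≡ one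

  StarStar : Set a
  StarStar = ∀ x y z → y ⇒ z ≡ one → (z ⇒ x) ⇒ (y ⇒ x) ≡ one

  An : Set a
  An = ∀ x y → x ⇒ y ≡ one → y ⇒ x ≡ one → x ≡ y

  Pi : Set a
  Pi = ∀ x y → y ⇒ (y ⇒ x) ≡ y ⇒ x

  Pimpl : Set a
  Pimpl = ∀ x y z → x ⇒ (y ⇒ z) ≡ (x ⇒ y) ⇒ (x ⇒ z)

  P1 : Set a
  P1 = ∀ x y z → (x ⇒ (y ⇒ z)) ⇒ ((x ⇒ y) ⇒ (x ⇒ z)) ≡ one

  P2 : Set a
  P2 = ∀ x y z → ((x ⇒ y) ⇒ (x ⇒ z)) ⇒ (x ⇒ (y ⇒ z)) ≡ one

module Submission where

open import Defs
open import Level using (Level)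
open import Data.Product using (_×_; _,_)
open import Relation.Binary.PropositionalEquality

-- (p-2) is (**) applied to y → (x → y) = 1 and rewritten by (Ex); (p-1) is (B) at
-- z := x → z, rewritten by (Ex) and (pi). Under (An), (p-1) and (p-2) together are (pimpl).

module _ {a : Level} (𝔸 : Alg20 a) where
  open Alg20 𝔸
  open ≡-Reasoning

  re∧l∧ex⇒K : Re 𝔸 → L 𝔸 → Ex 𝔸 → ∀ x y → y ⇒ (x ⇒ y) ≡ one
  re∧l∧ex⇒K re l ex x y = begin
    y ⇒ (x ⇒ y)  ≡⟨ ex y x y ⟩
    x ⇒ (y ⇒ y)  ≡⟨ cong (x ⇒_) (re y) ⟩
    x ⇒ one      ≡⟨ l x ⟩
    one          ∎

  re∧l∧ex∧starStar⇒p2 : Re 𝔸 → L 𝔸 → Ex 𝔸 → StarStar 𝔸 → P2 𝔸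
  re∧l∧ex∧starStar⇒p2 re l ex ss x y z =
    subst (λ t → ((x ⇒ y) ⇒ (x ⇒ z)) ⇒ t ≡ one) (ex y x z)
      (ss (x ⇒ z) y (x ⇒ y) (re∧l∧ex⇒K re l ex x y))

  ex∧b∧pi⇒p1 : Ex 𝔸 → B 𝔸 → Pi 𝔸 → P1 𝔸
  ex∧b∧pi⇒p1 ex b pi x y z =
    subst₂ (λ u v → u ⇒ ((x ⇒ y) ⇒ v) ≡ one) (ex y x z) (pi z x) (b x y (x ⇒ z))

  p1∧p2∧an⇒pimpl : P1 𝔸 → P2 𝔸 → An 𝔸 → Pimpl 𝔸
  p1∧p2∧an⇒pimpl p1 p2 an x y z = an _ _ (p1 x y z) (p2 x y z)

proposition6p3 : ∀ {a : Level} (𝔸 : Alg20 a) →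
      (Re 𝔸 → L 𝔸 → Ex 𝔸 → StarStar 𝔸 → P2 𝔸)
    × (Ex 𝔸 → B 𝔸 → Star 𝔸 → Pi 𝔸 → P1 𝔸)
    × (P1 𝔸 → P2 𝔸 → An 𝔸 → Pimpl 𝔸)
    × (Re 𝔸 → Ex 𝔸 → B 𝔸 → StarStar 𝔸 → Star 𝔸 → L 𝔸 → An 𝔸 → Pi 𝔸 → Pimpl 𝔸)
proposition6p3 𝔸 =
    re∧l∧ex∧starStar⇒p2 𝔸
  , (λ ex b _ pi → ex∧b∧pi⇒p1 𝔸 ex b pi)
  , p1∧p2∧an⇒pimpl 𝔸
  , λ re ex b ss _ l an pi →
      p1∧p2∧an⇒pimpl 𝔸 (ex∧b∧pi⇒p1 𝔸 ex b pi) (re∧l∧ex∧starStar⇒p2 𝔸 re l ex ss) an
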